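{- For every integer $m>3$: (1) $|V(J'(m,2))|=\binom{m}{2}+m$; (2) $\mathrm{cc}(J'(m,2))=m$; (3) $Z_+(J'(m,2))=\binom{m}{2}$; (4) $Z_+(J'(m,2))=|V(J'(m,2))|-\mathrm{cc}(J'(m,2))$.
   Context: $J'(m,2)$ is the graph whose vertices are all subsets of $\{1,\dots,m\}$ of size $1$ or $2$, two distinct vertices being adjacent iff the subsets intersect. $\mathrm{cc}(X)$ is the minimum number of cliques (vertex sets inducing complete subgraphs) needed so that every edge lies inside one of them. Positive zero forcing: a set $B$ of vertices is coloured black, the rest white; if $W_1,\dots,W_k$ are the vertex sets of the components of $X-B$ ($B$ the current black set), $u\in B$, and $w$ is the only white neighbour of $u$ in $X[W_i\cup B]$, then $w$ may be coloured black. $S$ is a positive zero forcing set if starting from $S$ black all vertices eventually become black; $Z_+(X)$ is the minimum size of such a set. -}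

module Defs where

open import Level using (0ℓ)
open import Data.Nat using (ℕ; _+_; _≤_)
open import Data.Nat.Combinatorics using (_C_)
open import Data.Fin using (Fin)
open import Data.Fin.Subset using (Subset; _∈_; ∣_∣)
open import Data.Product using (Σ; ∃; ∃-syntax; _×_; _,_; proj₁)
open import Data.Sum using (_⊎_)
open import Data.List using (List; length)
import Data.List.Membership.Propositional as LM
open import Data.List.Relation.Unary.Unique.Propositional using (Unique)
open import Relation.Nullary using (¬_)
open import Relation.Binary.PropositionalEquality using (_≡_; _≢_)
open import Relation.Binary.Construct.Closure.ReflexiveTransitive using (Star)
open import Function.Bundles using (_↔_)

record Graph : Set₁ where
  field
    V   : Set
    Adj : V → V → Set

open Graph public

HasOrder : Graph → ℕ → Set
HasOrder X n = V X ↔ Fin n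

IsClique : (X : Graph) → (V X → Set) → Set
IsClique X C = ∀ u v → C u → C v → u ≢ v → Adj X u v

CliqueCover : Graph → ℕ → Set₁
CliqueCover X k =
  Σ (Fin k → V X → Set) λ C →
    (∀ i → IsClique X (C i)) ×
    (∀ u v → Adj X u v → ∃[ i ] (C i u × C i v))

HasCC : Graph → ℕ → Set₁
HasCC X k = CliqueCover X k × (∀ j → CliqueCover X j → k ≤ j)

module _ (X : Graph) where

  SameComp : (V X → Set) → V X → V X → Set
  SameComp B = Star (λ x y → ¬ B x × ¬ B y × Adj X x y)

  -- u may force w: u black, w white neighbour of u, and w is the only
  -- white neighbour of u in X[W ∪ B] where W is the component of X - B
  -- containing w
  PosForce : (V X → Set) → V X → V X → Set
  PosForce B u w =
    B u × ¬ B w × Adj X u w ×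
    (∀ w' → ¬ B w' → SameComp B w w' → Adj X u w' → w' ≡ w)

  data Forcing : (V X → Set) → (V X → Set) → Set₁ where
    done  : ∀ {B} → Forcing B B
    force : ∀ {B B'} u w → PosForce B u w →
            Forcing (λ x → B x ⊎ x ≡ w) B' → Forcing B B'

  IsPZFSet : List (V X) → Set₁
  IsPZFSet S = Σ (V X → Set) λ B' → Forcing (λ x → x LM.∈ S) B' × (∀ v → B' v)

HasZplus : Graph → ℕ → Set₁
HasZplus X k =
  (Σ (List (V X)) λ S → Unique S × length S ≡ k × IsPZFSet X S) ×
  (∀ S → Unique S → IsPZFSet X S → k ≤ length S)

J'V : ℕ → Set
J'V m = Σ (Subset m) λ s → ∣ s ∣ ≡ 1 ⊎ ∣ s ∣ ≡ 2

J' : ℕ → Graph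
J' m = record
  { V   = J'V m
  ; Adj = λ u v → u ≢ v × ∃[ i ] (i ∈ proj₁ u × i ∈ proj₁ v)
  }

module Submission where

-- The m stars {v : i ∈ v} are cliques
-- covering all edges, while no clique contains two singletons, so the m edges joining {i} to a
-- pair through i need m distinct cliques: cc = m. With all pairs black the white singletons are
-- pairwise non-adjacent, so a pair through i forces {i}: Z₊ ≤ C(m,2). Conversely a force u → w
-- turns the whole clique of a cover containing u and w black (a white vertex of it would be a
-- second white neighbour of u in the component of w), so there are at most cc forces and
-- Z₊ ≥ |V| − cc = C(m,2).

open import Defs
open import Data.Nat using (ℕ; zero; suc; _+_; _<_; _≤_; s≤s)
open import Data.Nat.Properties
  using (suc-injective; ≡-irrelevant; +-comm; +-suc; +-identityʳ; +-monoʳ-≤; +-cancelʳ-≤; ≤-antisym; module ≤-Reasoning)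
open import Data.Nat.Combinatorics using (_C_; nC1≡n; nCk+nC[k+1]≡[n+1]C[k+1])
open import Data.Product using (_×_; Σ; ∃₂; ∃-syntax; _,_; proj₁; proj₂)
open import Data.Sum using (_⊎_; inj₁; inj₂; [_,_]′)
import Data.Sum as Sum
open import Data.Bool using (true; false)
open import Data.Vec using ([]; _∷_; here; there)
open import Data.Fin using (Fin; zero; suc)
open import Data.Fin.Properties using (injective⇒≤; +↔⊎; _≟_)
open import Data.Fin.Permutation using (↔⇒≡)
open import Data.Fin.Subset using (Subset; ⁅_⁆; ∣_∣) renaming (_∈_ to _∈ₛ_; ⊥ to ∅)
open import Data.Fin.Subset.Properties using (∣⊥∣≡0; ∣⁅x⁆∣≡1; x∈⁅x⁆; x∈⁅y⁆⇒x≡y)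
open import Data.List using (List; []; _∷_; length; lookup; tabulate; allFin; _++_)
open import Data.List.Properties using (length-tabulate; length-++)
open import Data.List.Membership.Propositional using (_∈_; _∉_)
open import Data.List.Membership.Propositional.Properties
  using (∈-lookup; ∈-tabulate⁺; ∈-tabulate⁻; ∈-allFin; ∈-++⁺ˡ; ∈-++⁺ʳ)
open import Data.List.Relation.Unary.Any using (here; there; index)
open import Data.List.Relation.Unary.Any.Properties using (lookup-index)
open import Data.List.Relation.Unary.All as All using (All; []; _∷_)
open import Data.List.Relation.Unary.All.Properties using (¬Any⇒All¬)
open import Data.List.Relation.Unary.Unique.Propositional using (Unique)
open import Data.List.Relation.Unary.Unique.Propositional.Properties using (tabulate⁺; allFin⁺)
open import Data.List.Relation.Unary.AllPairs using ([]; _∷_)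
open import Data.Empty using (⊥-elim)
open import Function using (_∘_)
open import Function.Bundles using (_↔_; Inverse; Injection; mk↔ₛ′)
open import Function.Properties.Inverse using (↔-sym; ↔-trans; ↔⇒↣)
open import Function.Related.TypeIsomorphisms using (Σ-distribˡ-⊎)
open import Data.Sum.Function.Propositional using (_⊎-↔_)
open import Relation.Nullary using (¬_; yes; no)
open import Relation.Binary.PropositionalEquality
open import Relation.Binary.Construct.Closure.ReflexiveTransitive using (ε; _◅_)

↔⇒≤ : ∀ {A : Set} {n} → A ↔ Fin n → (xs : List A) → (∀ x → x ∈ xs) → n ≤ length xs
↔⇒≤ {n = n} iso xs complete = injective⇒≤ {f = position} position-injective
  where
  open Inverse iso
  position : Fin n → Fin (length xs)
  position i = index (complete (from i))
  position-injective : ∀ {i j} → position i ≡ position j → i ≡ j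
  position-injective {i} {j} eq = Injection.injective (↔⇒↣ (↔-sym iso))
    (trans (lookup-index (complete (from i)))
      (trans (cong (lookup xs) eq) (sym (lookup-index (complete (from j))))))

lookup-injective : ∀ {A : Set} {xs : List A} → Unique xs → ∀ {i j} → lookup xs i ≡ lookup xs j → i ≡ j
lookup-injective (_ ∷ _) {zero} {zero} _ = refl
lookup-injective (x∉xs ∷ _) {zero} {suc j} eq = ⊥-elim (All.lookup x∉xs (∈-lookup j) eq)
lookup-injective (x∉xs ∷ _) {suc i} {zero} eq = ⊥-elim (All.lookup x∉xs (∈-lookup i) (sym eq))
lookup-injective (_ ∷ unique) {suc i} {suc j} eq = cong suc (lookup-injective unique eq)

Unique⇒length≤ : ∀ {k} {xs : List (Fin k)} → Unique xs → length xs ≤ k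
Unique⇒length≤ unique = injective⇒≤ (lookup-injective unique)

⊎-↔-Fin+ : ∀ {A B : Set} {a b} → A ↔ Fin a → B ↔ Fin b → (A ⊎ B) ↔ Fin (a + b)
⊎-↔-Fin+ A↔a B↔b = ↔-trans (A↔a ⊎-↔ B↔b) (↔-sym +↔⊎)

↔-Fin-≡ : ∀ {A : Set} {a b} → a ≡ b → A ↔ Fin a → A ↔ Fin b
↔-Fin-≡ {A} = subst (λ n → A ↔ Fin n)

SubsetOfSize : ℕ → ℕ → Set
SubsetOfSize m k = Σ (Subset m) λ s → ∣ s ∣ ≡ k

SubsetOfSize-≡ : ∀ {m k} {s t : Subset m} {p : ∣ s ∣ ≡ k} {q : ∣ t ∣ ≡ k} →
                 s ≡ t → _≡_ {A = SubsetOfSize m k} (s , p) (t , q)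
SubsetOfSize-≡ {p = p} {q} refl = cong (_ ,_) (≡-irrelevant p q)

∣p∣≡0⇒p≡∅ : ∀ {m} (p : Subset m) → ∣ p ∣ ≡ 0 → p ≡ ∅
∣p∣≡0⇒p≡∅ [] _ = refl
∣p∣≡0⇒p≡∅ (false ∷ p) ∣p∣≡0 = cong (false ∷_) (∣p∣≡0⇒p≡∅ p ∣p∣≡0)

∣p∣≡1⇒p≡⁅x⁆ : ∀ {m} (p : Subset m) → ∣ p ∣ ≡ 1 → ∃[ x ] p ≡ ⁅ x ⁆
∣p∣≡1⇒p≡⁅x⁆ (true ∷ p) ∣p∣≡1 = zero , cong (true ∷_) (∣p∣≡0⇒p≡∅ p (suc-injective ∣p∣≡1))
∣p∣≡1⇒p≡⁅x⁆ (false ∷ p) ∣p∣≡1 with x , refl ← ∣p∣≡1⇒p≡⁅x⁆ p ∣p∣≡1 = suc x , refl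

∣p∣≡1⇒x∈p⇒p≡⁅x⁆ : ∀ {m} (p : Subset m) → ∣ p ∣ ≡ 1 → ∀ {x} → x ∈ₛ p → p ≡ ⁅ x ⁆
∣p∣≡1⇒x∈p⇒p≡⁅x⁆ p ∣p∣≡1 x∈p with y , refl ← ∣p∣≡1⇒p≡⁅x⁆ p ∣p∣≡1 =
  cong ⁅_⁆ (sym (x∈⁅y⁆⇒x≡y y x∈p))

SubsetOfSize↔Fin[C] : ∀ m k → SubsetOfSize m k ↔ Fin (m C k)
SubsetOfSize↔Fin[C] m zero = mk↔ₛ′ (λ _ → zero) (λ _ → ∅ , ∣⊥∣≡0 m) (λ { zero → refl })
  (λ (s , ∣s∣≡0) → SubsetOfSize-≡ (sym (∣p∣≡0⇒p≡∅ s ∣s∣≡0)))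
SubsetOfSize↔Fin[C] zero (suc k) = mk↔ₛ′ (λ { ([] , ()) }) (λ ()) (λ ()) (λ { ([] , ()) })
SubsetOfSize↔Fin[C] (suc m) (suc k) =
  ↔-trans split
    (↔-Fin-≡ (nCk+nC[k+1]≡[n+1]C[k+1] m k)
      (⊎-↔-Fin+ (SubsetOfSize↔Fin[C] m k) (SubsetOfSize↔Fin[C] m (suc k))))
  where
  split : SubsetOfSize (suc m) (suc k) ↔ (SubsetOfSize m k ⊎ SubsetOfSize m (suc k))
  split = mk↔ₛ′
    (λ { (true ∷ s , p) → inj₁ (s , suc-injective p) ; (false ∷ s , p) → inj₂ (s , p) })
    (λ { (inj₁ (s , p)) → true ∷ s , cong suc p ; (inj₂ (s , p)) → false ∷ s , p })
    (λ { (inj₁ _) → cong inj₁ (SubsetOfSize-≡ refl) ; (inj₂ _) → refl })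
    (λ { (true ∷ _ , _) → SubsetOfSize-≡ refl ; (false ∷ _ , _) → refl })

module _ (X : Graph) where

  SameComp-trivial : ∀ {B} → (∀ x y → ¬ B x → ¬ B y → ¬ Adj X x y) →
                     ∀ {x y} → SameComp X B x y → x ≡ y
  SameComp-trivial _ ε = refl
  SameComp-trivial whitesIndependent ((¬Bx , ¬By , x~y) ◅ _) =
    ⊥-elim (whitesIndependent _ _ ¬Bx ¬By x~y)

  -- Black sets are arbitrary predicates, so "all black" is only available doubly negated.
  Blackened : (V X → Set) → (V X → Set) → Set
  Blackened B K = ∀ x → K x → ¬ ¬ B x

  Blackened-mono : ∀ {B B' K} → (∀ {x} → B x → B' x) → Blackened B K → Blackened B' K
  Blackened-mono B⊆B' blackened x Kx x∉B' = blackened x Kx (x∉B' ∘ B⊆B')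

  force-blackens-clique : ∀ {B K u w} → IsClique X K → K u → K w → PosForce X B u w →
                          Blackened (λ x → B x ⊎ x ≡ w) K
  force-blackens-clique {B = B} {u = u} {w = w} clique Ku Kw (Bu , ¬Bw , _ , onlyWhite) x Kx x∉B' =
    x≢w (onlyWhite x ¬Bx (w~x ◅ ε) (clique u x Ku Kx (x≢u ∘ sym)))
    where
    ¬Bx : ¬ B x
    ¬Bx = x∉B' ∘ inj₁
    x≢w : x ≢ w
    x≢w = x∉B' ∘ inj₂
    x≢u : x ≢ u
    x≢u refl = ¬Bx Bu
    w~x : ¬ B w × ¬ B x × Adj X w x
    w~x = ¬Bw , ¬Bx , clique w x Kw Kx (x≢w ∘ sym)

  module _ {k} (K : Fin k → V X → Set) (clique : ∀ i → IsClique X (K i))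
           (covers : ∀ u v → Adj X u v → ∃[ i ] (K i u × K i v)) where

    -- Every force consumes a clique that was not yet blackened and blackens it.
    forced-vertices : ∀ {B B'} → Forcing X B B' →
      (used : List (Fin k)) → Unique used → All (Blackened B ∘ K) used →
      ∃₂ λ (ws : List (V X)) (used' : List (Fin k)) →
        Unique used' × length used' ≡ length ws + length used × (∀ x → B' x → B x ⊎ x ∈ ws)
    forced-vertices done used unique _ = [] , used , unique , refl , λ _ → inj₁
    forced-vertices (force u w f@(_ , ¬Bw , u~w , _) rest) used unique blackened
      with c , Ku , Kw ← covers u w u~w
      with ws , used' , unique' , length-used' , B'⊆ ←
             forced-vertices rest (c ∷ used)
               (¬Any⇒All¬ used (λ c∈used → All.lookup blackened c∈used w Kw ¬Bw) ∷ unique)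
               (force-blackens-clique (clique c) Ku Kw f ∷ All.map (Blackened-mono inj₁) blackened)
      = w ∷ ws , used' , unique' , trans length-used' (+-suc _ _) ,
        λ x → [ Sum.map₂ here , inj₂ ∘ there ]′ ∘ B'⊆ x

  |V|≤Z₊+cc : ∀ {n k S} → HasOrder X n → CliqueCover X k → IsPZFSet X S → n ≤ length S + k
  |V|≤Z₊+cc {n} {k} {S} order (K , clique , covers) (B' , forcing , allBlack)
    with ws , used , unique , length-used , B'⊆ ← forced-vertices K clique covers forcing [] [] []
    = begin
      n                    ≤⟨ ↔⇒≤ order (S ++ ws) covered ⟩
      length (S ++ ws)     ≡⟨ length-++ S ⟩
      length S + length ws ≤⟨ +-monoʳ-≤ (length S) |ws|≤k ⟩
      length S + k         ∎
    where
    open ≤-Reasoning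
    covered : ∀ x → x ∈ S ++ ws
    covered x = [ ∈-++⁺ˡ , ∈-++⁺ʳ S ]′ (B'⊆ x (allBlack x))
    |ws|≤k : length ws ≤ k
    |ws|≤k = subst (_≤ k) (trans length-used (+-identityʳ _)) (Unique⇒length≤ unique)

HasOrder-unique : ∀ {X a b} → HasOrder X a → HasOrder X b → a ≡ b
HasOrder-unique X↔a X↔b = ↔⇒≡ (↔-trans (↔-sym X↔a) X↔b)

HasCC-unique : ∀ {X a b} → HasCC X a → HasCC X b → a ≡ b
HasCC-unique (coverA , minimalA) (coverB , minimalB) = ≤-antisym (minimalA _ coverB) (minimalB _ coverA)

HasZplus-unique : ∀ {X a b} → HasZplus X a → HasZplus X b → a ≡ b
HasZplus-unique ((S , uniqueS , refl , forcingS) , minimalA)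
                ((T , uniqueT , refl , forcingT) , minimalB) =
  ≤-antisym (minimalA T uniqueT forcingT) (minimalB S uniqueS forcingS)

J'V-≡ : ∀ {m} {u v : J'V m} → proj₁ u ≡ proj₁ v → u ≡ v
J'V-≡ {u = s , inj₁ p} {.s , inj₁ q} refl = cong (λ r → s , inj₁ r) (≡-irrelevant p q)
J'V-≡ {u = s , inj₂ p} {.s , inj₂ q} refl = cong (λ r → s , inj₂ r) (≡-irrelevant p q)
J'V-≡ {u = s , inj₁ p} {.s , inj₂ q} refl with () ← trans (sym p) q
J'V-≡ {u = s , inj₂ p} {.s , inj₁ q} refl with () ← trans (sym p) q

J'-order : ∀ m → HasOrder (J' m) (m C 2 + m)
J'-order m =
  ↔-trans Σ-distribˡ-⊎
    (↔-Fin-≡ (trans (cong (_+ m C 2) (nC1≡n m)) (+-comm m (m C 2)))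
      (⊎-↔-Fin+ (SubsetOfSize↔Fin[C] m 1) (SubsetOfSize↔Fin[C] m 2)))

J'-sym : ∀ {m} {u v : J'V m} → Adj (J' m) u v → Adj (J' m) v u
J'-sym (u≢v , i , i∈u , i∈v) = u≢v ∘ sym , i , i∈v , i∈u

singleton : ∀ {m} → Fin m → J'V m
singleton i = ⁅ i ⁆ , inj₁ (∣⁅x⁆∣≡1 i)

singleton-injective : ∀ {m} {i j : Fin m} → singleton i ≡ singleton j → i ≡ j
singleton-injective {i = i} {j} eq = x∈⁅y⁆⇒x≡y j (subst (i ∈ₛ_) (cong proj₁ eq) (x∈⁅x⁆ i))

singletons-nonadjacent : ∀ {m} (u v : J'V m) → ∣ proj₁ u ∣ ≡ 1 → ∣ proj₁ v ∣ ≡ 1 → ¬ Adj (J' m) u v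
singletons-nonadjacent (s , _) (t , _) ∣s∣≡1 ∣t∣≡1 (u≢v , i , i∈s , i∈t) =
  u≢v (J'V-≡ (trans (∣p∣≡1⇒x∈p⇒p≡⁅x⁆ s ∣s∣≡1 i∈s) (sym (∣p∣≡1⇒x∈p⇒p≡⁅x⁆ t ∣t∣≡1 i∈t))))

star : ∀ {m} → Fin m → J'V m → Set
star i v = i ∈ₛ proj₁ v

starCover : ∀ m → CliqueCover (J' m) m
starCover m =
  star ,
  (λ i u v i∈u i∈v u≢v → u≢v , i , i∈u , i∈v) ,
  (λ { u v (_ , i , i∈u , i∈v) → i , i∈u , i∈v })

pairToVertex : ∀ {m} → SubsetOfSize m 2 → J'V m
pairToVertex (s , ∣s∣≡2) = s , inj₂ ∣s∣≡2

allPairs : ∀ m → List (J'V m)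
allPairs m = tabulate (pairToVertex ∘ Inverse.from (SubsetOfSize↔Fin[C] m 2))

allPairs-unique : ∀ m → Unique (allPairs m)
allPairs-unique m = tabulate⁺
  (Injection.injective (↔⇒↣ (↔-sym (SubsetOfSize↔Fin[C] m 2))) ∘ SubsetOfSize-≡ ∘ cong proj₁)

allPairs-length : ∀ m → length (allPairs m) ≡ m C 2
allPairs-length m = length-tabulate _

∈-allPairs : ∀ {m} s (∣s∣≡2 : ∣ s ∣ ≡ 2) → (s , inj₂ ∣s∣≡2) ∈ allPairs m
∈-allPairs {m} s ∣s∣≡2 =
  subst (_∈ allPairs m) (cong pairToVertex (Inverse.strictlyInverseʳ (SubsetOfSize↔Fin[C] m 2) _))
    (∈-tabulate⁺ (Inverse.to (SubsetOfSize↔Fin[C] m 2) (s , ∣s∣≡2)))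

singleton∉allPairs : ∀ {m} (i : Fin m) → singleton i ∉ allPairs m
singleton∉allPairs i i∈ with _ , () ← ∈-tabulate⁻ i∈

PairsBlack : ∀ {m} → (J'V m → Set) → Set
PairsBlack {m} B = ∀ (s : Subset m) (∣s∣≡2 : ∣ s ∣ ≡ 2) → B (s , inj₂ ∣s∣≡2)

white-is-singleton : ∀ {m} {B : J'V m → Set} → PairsBlack B → ∀ v → ¬ B v → ∣ proj₁ v ∣ ≡ 1
white-is-singleton _ (s , inj₁ ∣s∣≡1) _ = ∣s∣≡1
white-is-singleton pairsBlack (s , inj₂ ∣s∣≡2) ¬Bv = ⊥-elim (¬Bv (pairsBlack s ∣s∣≡2))

all-black : ∀ {m} {B : J'V m → Set} → PairsBlack B → (∀ i → B (singleton i)) → ∀ v → B v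
all-black pairsBlack _ (s , inj₂ ∣s∣≡2) = pairsBlack s ∣s∣≡2
all-black {B = B} _ singletonsBlack (s , inj₁ ∣s∣≡1) with i , refl ← ∣p∣≡1⇒p≡⁅x⁆ s ∣s∣≡1 =
  subst B (J'V-≡ refl) (singletonsBlack i)

module _ {n : ℕ} where

  pairWith : Fin (2 + n) → Subset (2 + n)
  pairWith zero = true ∷ ⁅ zero ⁆
  pairWith (suc i) = true ∷ ⁅ i ⁆

  ∣pairWith∣≡2 : ∀ i → ∣ pairWith i ∣ ≡ 2
  ∣pairWith∣≡2 zero = cong suc (∣⁅x⁆∣≡1 {suc n} zero)
  ∣pairWith∣≡2 (suc i) = cong suc (∣⁅x⁆∣≡1 i)

  ∈-pairWith : ∀ i → i ∈ₛ pairWith i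
  ∈-pairWith zero = here
  ∈-pairWith (suc i) = there (x∈⁅x⁆ i)

  pairVertex : Fin (2 + n) → J'V (2 + n)
  pairVertex i = pairWith i , inj₂ (∣pairWith∣≡2 i)

  singleton~pairVertex : ∀ i → Adj (J' (2 + n)) (singleton i) (pairVertex i)
  singleton~pairVertex i = singleton≢pairVertex , i , x∈⁅x⁆ i , ∈-pairWith i
    where
    singleton≢pairVertex : singleton i ≢ pairVertex i
    singleton≢pairVertex eq with () ←
      trans (sym (∣⁅x⁆∣≡1 i)) (trans (cong (∣_∣ ∘ proj₁) eq) (∣pairWith∣≡2 i))

  J'-cc-lower-bound : ∀ {j} → CliqueCover (J' (2 + n)) j → 2 + n ≤ j
  J'-cc-lower-bound (K , clique , covers) = injective⇒≤ {f = cliqueOf} cliqueOf-injective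
    where
    cliqueOf : Fin (2 + n) → _
    cliqueOf i = proj₁ (covers _ _ (singleton~pairVertex i))
    cliqueOf-contains : ∀ i → K (cliqueOf i) (singleton i)
    cliqueOf-contains i = proj₁ (proj₂ (covers _ _ (singleton~pairVertex i)))
    cliqueOf-injective : ∀ {a b} → cliqueOf a ≡ cliqueOf b → a ≡ b
    cliqueOf-injective {a} {b} eq with a ≟ b
    ... | yes a≡b = a≡b
    ... | no a≢b = ⊥-elim
      (singletons-nonadjacent (singleton a) (singleton b) (∣⁅x⁆∣≡1 a) (∣⁅x⁆∣≡1 b)
          (clique (cliqueOf b) _ _ (subst (λ c → K c (singleton a)) eq (cliqueOf-contains a))
            (cliqueOf-contains b) (a≢b ∘ singleton-injective)))

  J'-cc : HasCC (J' (2 + n)) (2 + n)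
  J'-cc = starCover (2 + n) , λ _ → J'-cc-lower-bound

  pairVertex-forces-singleton : ∀ {B} → PairsBlack B → ∀ i → ¬ B (singleton i) →
                                PosForce (J' (2 + n)) B (pairVertex i) (singleton i)
  pairVertex-forces-singleton {B} pairsBlack i white =
    pairsBlack _ (∣pairWith∣≡2 i) , white , J'-sym (singleton~pairVertex i) ,
    λ _ _ sameComp _ → sym (SameComp-trivial (J' (2 + n)) whitesIndependent sameComp)
    where
    whitesIndependent : ∀ x y → ¬ B x → ¬ B y → ¬ Adj (J' (2 + n)) x y
    whitesIndependent x y ¬Bx ¬By =
      singletons-nonadjacent x y (white-is-singleton {B = B} pairsBlack x ¬Bx)
        (white-is-singleton {B = B} pairsBlack y ¬By)

  force-singletons : ∀ {B} → PairsBlack B → (is : List (Fin (2 + n))) → Unique is →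
                     All (λ i → ¬ B (singleton i)) is →
                     ∃[ B' ] Forcing (J' (2 + n)) B B' × (∀ x → B x → B' x) × All (B' ∘ singleton) is
  force-singletons _ [] _ _ = _ , done , (λ _ Bx → Bx) , []
  force-singletons {B} pairsBlack (i ∷ is) (i∉is ∷ unique) (white ∷ whites)
    with force-singletons {λ x → B x ⊎ x ≡ singleton i} (λ s ∣s∣≡2 → inj₁ (pairsBlack s ∣s∣≡2))
           is unique
           (All.zipWith (λ (i≢j , white) → still-white i≢j white) (i∉is , whites))
    where
    still-white : ∀ {j} → i ≢ j → ¬ B (singleton j) → ¬ (B (singleton j) ⊎ singleton j ≡ singleton i)
    still-white _ white (inj₁ black) = white black
    still-white i≢j _ (inj₂ eq) = i≢j (sym (singleton-injective eq))
  ... | B' , forcing , B⊆B' , blackened =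
    B' , force _ _ (pairVertex-forces-singleton pairsBlack i white) forcing ,
    (λ x → B⊆B' x ∘ inj₁) , B⊆B' _ (inj₂ refl) ∷ blackened

  allPairs-forcing : IsPZFSet (J' (2 + n)) (allPairs (2 + n))
  allPairs-forcing =
    let B' , forcing , B⊆B' , singletonsBlack =
          force-singletons {_∈ allPairs (2 + n)} ∈-allPairs (allFin (2 + n)) (allFin⁺ (2 + n))
            (All.tabulate (λ {i} _ → singleton∉allPairs i))
    in B' , forcing ,
       all-black (λ s ∣s∣≡2 → B⊆B' _ (∈-allPairs s ∣s∣≡2))
         (λ i → All.lookup singletonsBlack (∈-allFin i))

  J'-Z₊ : HasZplus (J' (2 + n)) ((2 + n) C 2)
  J'-Z₊ =
    (allPairs (2 + n) , allPairs-unique (2 + n) , allPairs-length (2 + n) , allPairs-forcing) ,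
    λ S _ forcing → +-cancelʳ-≤ (2 + n) ((2 + n) C 2) (length S)
      (|V|≤Z₊+cc (J' (2 + n)) (J'-order (2 + n)) (starCover (2 + n)) forcing)

lemma8p2 : ∀ (m : ℕ) → 3 < m →
    HasOrder (J' m) ((m C 2) + m) ×
    HasCC (J' m) m ×
    HasZplus (J' m) (m C 2) ×
    (∀ n c z → HasOrder (J' m) n → HasCC (J' m) c → HasZplus (J' m) z →
      z + c ≡ n)
lemma8p2 1 (s≤s ())
lemma8p2 (suc (suc n)) _ =
  J'-order (2 + n) , J'-cc , J'-Z₊ ,
  λ _ _ _ order cc z₊ →
    trans (cong₂ _+_ (HasZplus-unique z₊ (J'-Z₊ {n})) (HasCC-unique cc (J'-cc {n})))
          (HasOrder-unique {J' (2 + n)} (J'-order (2 + n)) order)
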